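{- For each positive integer $k$, the number of piecewise constant functions in $\widetilde{\mathcal{P}}_k$ is the Catalan number $C_{k-1}=\frac{1}{k}\binom{2k-2}{k-1}$.
   Context: The class $\mathcal{P}$ consists of all functions $f:[0,1]\to[0,1]$ such that: $f$ is weakly decreasing; $f$ is piecewise linear with finitely many non-differentiable points; all non-differentiable points of $f$ are rational numbers in $[0,1]$; there is $\varepsilon>0$ with $f(x)=1$ for all $0\le x<\varepsilon$; $f(1)>0$; and for every $a\in(0,1)$, $\lim_{x\searrow a} f(x) > 1-a$. For a positive integer $k$, $\widetilde{\mathcal{P}}_k$ is the set of $f\in\mathcal{P}$ such that: $k f(i/k)\in\mathbb{Z}$ for each $i\in\{1,\ldots,k\}$; $f$ is upper-semicontinuous; and for each $i\in\{1,\ldots,k\}$ the restriction of $f$ to $((i-1)/k,i/k)$ is linear with a non-positive integer slope.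
   Formalization: The functions in $\widetilde{\mathcal{P}}_k$ are defined only on the rationals in [0,1] and take rational values, instead of being real functions on [0,1]. -}

module Defs where

open import Data.Nat as ℕ using (ℕ; suc; NonZero)
open import Data.Integer as ℤ using (ℤ; +_)
open import Data.Rational using (ℚ; _/_; 0ℚ; 1ℚ; _+_; _*_; _-_; ∣_∣; _<_; _≤_)
open import Data.Fin using (Fin)
open import Data.List using (List)
open import Data.List.Membership.Propositional using (_∈_)
open import Data.Product using (Σ; ∃; _×_; _,_)
open import Relation.Binary.PropositionalEquality using (_≡_)
open import Relation.Nullary using (¬_)

-- Functions [0,1] → [0,1] are modelled on the rational points of [0,1]
-- as f : ℚ → ℚ, of which only the values on [0,1] matter.

In01 : ℚ → Set
In01 x = 0ℚ ≤ x × x ≤ 1ℚ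

frac : (i k : ℕ) → .{{NonZero k}} → ℚ
frac i k = + i / k

ℤ→ℚ : ℤ → ℚ
ℤ→ℚ z = z / 1

MapsInto01 : (ℚ → ℚ) → Set
MapsInto01 f = ∀ x → In01 x → In01 (f x)

WeaklyDecreasing : (ℚ → ℚ) → Set
WeaklyDecreasing f = ∀ x y → In01 x → In01 y → x ≤ y → f y ≤ f x

-- f is affine (linear) on every connected component of [0,1] minus the finite
-- set ts of (possible) non-differentiable points: whenever x < y < z lie in [0,1]
-- and no point of ts lies in [x,z], the three values are collinear.
NoBreakIn : List ℚ → ℚ → ℚ → Set
NoBreakIn ts x z = ∀ t → t ∈ ts → ¬ (x ≤ t × t ≤ z)

PiecewiseLinear : (ℚ → ℚ) → Set
PiecewiseLinear f =
  ∃ λ (ts : List ℚ) → ∀ x y z → 0ℚ ≤ x → x < y → y < z → z ≤ 1ℚ →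
    NoBreakIn ts x z → (f y - f x) * (z - x) ≡ (f z - f x) * (y - x)

PiecewiseConstant : (ℚ → ℚ) → Set
PiecewiseConstant f =
  ∃ λ (ts : List ℚ) → ∀ x z → 0ℚ ≤ x → x < z → z ≤ 1ℚ →
    NoBreakIn ts x z → f x ≡ f z

OneNearZero : (ℚ → ℚ) → Set
OneNearZero f = ∃ λ ε → 0ℚ < ε × (∀ x → 0ℚ ≤ x → x < ε → f x ≡ 1ℚ)

RightLimit : (ℚ → ℚ) → ℚ → ℚ → Set
RightLimit f a c =
  ∀ η → 0ℚ < η → ∃ λ δ → 0ℚ < δ ×
    (∀ x → a < x → x < a + δ → x ≤ 1ℚ → ∣ f x - c ∣ < η)

RightLimitAboveDiagonal : (ℚ → ℚ) → Set
RightLimitAboveDiagonal f =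
  ∀ a → 0ℚ < a → a < 1ℚ → ∃ λ c → RightLimit f a c × (1ℚ - a) < c

InP : (ℚ → ℚ) → Set
InP f = MapsInto01 f × WeaklyDecreasing f × PiecewiseLinear f ×
        OneNearZero f × (0ℚ < f 1ℚ) × RightLimitAboveDiagonal f

UpperSemicontinuous : (ℚ → ℚ) → Set
UpperSemicontinuous f =
  ∀ x → In01 x → ∀ η → 0ℚ < η → ∃ λ δ → 0ℚ < δ ×
    (∀ y → In01 y → ∣ y - x ∣ < δ → f y < f x + η)

InPtilde : (k : ℕ) → .{{NonZero k}} → (ℚ → ℚ) → Set
InPtilde k f =
  InP f ×
  (∀ i → 1 ℕ.≤ i → i ℕ.≤ k → ∃ λ (z : ℤ) → (+ k / 1) * f (frac i k) ≡ ℤ→ℚ z) ×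
  UpperSemicontinuous f ×
  (∀ i → 1 ℕ.≤ i → i ℕ.≤ k →
     ∃ λ (m : ℤ) → m ℤ.≤ + 0 × ∃ λ (b : ℚ) →
       ∀ x → frac (i ℕ.∸ 1) k < x → x < frac i k → f x ≡ ℤ→ℚ m * x + b)

_≈₀₁_ : (ℚ → ℚ) → (ℚ → ℚ) → Set
f ≈₀₁ g = ∀ x → In01 x → f x ≡ g x

-- the collection of functions (on [0,1]) satisfying P has exactly n elements:
-- an enumeration by Fin n, injective and surjective up to equality on [0,1]
HasExactly : ((ℚ → ℚ) → Set) → ℕ → Set
HasExactly P n =
  Σ (Fin n → (ℚ → ℚ)) λ g →
    (∀ i → P (g i)) ×
    (∀ i j → g i ≈₀₁ g j → i ≡ j) ×
    (∀ f → P f → ∃ λ i → f ≈₀₁ g i)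

{-# OPTIONS --safe #-}
module Submission where

-- A piecewise constant f in 𝒫̃_k has slope 0 on each cell (i/k, (i+1)/k); being decreasing and
-- upper semicontinuous, it equals dᵢ/k on the half-open cell (i/k, (i+1)/k] for integers
-- d₀ = k ≥ d₁ ≥ ⋯ ≥ d_{k-1}, and the right-limit condition at (i+1)/k says d_{i+1} + (i+1) > k.
-- Conversely every such sequence gives a step function in 𝒫̃_k.  Splitting on whether the next
-- value equals the previous one or lies below it, these sequences are counted by the ballot
-- numbers B(n,r) = C(2n+r, n+r) − C(2n+r, n+r+1), and B(k−1, 0) = C(2k−2, k−1)/k.

open import Data.Nat using (ℕ; suc)
open import Data.Rational using (ℚ)
open import Defs

module BallotNumbers where

  open import Data.Nat
  open import Data.Nat.Properties
  open import Data.Nat.Combinatorics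
  open import Data.Nat.Tactic.RingSolver using (solve-∀)
  open import Relation.Binary.PropositionalEquality
  open ≡-Reasoning

  ballot : ℕ → ℕ → ℕ
  ballot zero    r       = 1
  ballot (suc n) zero    = ballot n 1
  ballot (suc n) (suc r) = ballot n (suc (suc r)) + ballot (suc n) r

  [m+n]Cm≡[m+n]Cn : ∀ m n → (m + n) C m ≡ (m + n) C n
  [m+n]Cm≡[m+n]Cn m n = trans (nCk≡nC[n∸k] (m≤m+n m n)) (cong ((m + n) C_) (m+n∸m≡n m n))

  [1+k]*[1+n]C[1+k]≡[1+n]*nCk : ∀ n k → suc k * (suc n C suc k) ≡ suc n * (n C k)
  [1+k]*[1+n]C[1+k]≡[1+n]*nCk zero    zero    = refl
  [1+k]*[1+n]C[1+k]≡[1+n]*nCk zero    (suc k) = *-zeroʳ (suc (suc k))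
  [1+k]*[1+n]C[1+k]≡[1+n]*nCk (suc n) zero    =
    trans (+-identityʳ _) (trans (nC1≡n (suc (suc n))) (sym (*-identityʳ (suc (suc n)))))
  [1+k]*[1+n]C[1+k]≡[1+n]*nCk (suc n) (suc k) = begin
    suc (suc k) * (suc (suc n) C suc (suc k))   ≡⟨ cong (suc (suc k) *_) (nCk+nC[k+1]≡[n+1]C[k+1] (suc n) (suc k)) ⟨
    suc (suc k) * (e + f)                       ≡⟨ regroup k e f ⟩
    e + suc k * e + suc (suc k) * f             ≡⟨ cong₂ (λ x y → e + x + y) ([1+k]*[1+n]C[1+k]≡[1+n]*nCk n k)
                                                                            ([1+k]*[1+n]C[1+k]≡[1+n]*nCk n (suc k)) ⟩
    e + suc n * (n C k) + suc n * (n C suc k)   ≡⟨ factor e n (n C k) (n C suc k) ⟩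
    e + suc n * (n C k + n C suc k)             ≡⟨ cong (λ x → e + suc n * x) (nCk+nC[k+1]≡[n+1]C[k+1] n k) ⟩
    e + suc n * e                               ∎
    where
    e = suc n C suc k
    f = suc n C suc (suc k)
    regroup : ∀ k e f → suc (suc k) * (e + f) ≡ e + suc k * e + suc (suc k) * f
    regroup = solve-∀
    factor : ∀ e n a b → e + suc n * a + suc n * b ≡ e + suc n * (a + b)
    factor = solve-∀

  ballot[n,r]+[2n+r]C[1+n+r]≡[2n+r]C[n+r] :
    ∀ n r → ballot n r + (n + n + r) C suc (n + r) ≡ (n + n + r) C (n + r)
  ballot[n,r]+[2n+r]C[1+n+r]≡[2n+r]C[n+r] zero r =
    trans (cong (1 +_) (k>n⇒nCk≡0 (n<1+n r))) (sym (nCn≡1 r))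
  ballot[n,r]+[2n+r]C[1+n+r]≡[2n+r]C[n+r] (suc n) zero =
    subst₂ (λ T s → ballot n 1 + T C suc s ≡ T C s) (sym (top≡ n)) (sym (+-identityʳ (suc n))) (begin
      ballot n 1 + suc M C suc (suc n)            ≡⟨ cong (ballot n 1 +_) (nCk+nC[k+1]≡[n+1]C[k+1] M (suc n)) ⟨
      ballot n 1 + (M C suc n + M C suc (suc n))  ≡⟨ x+[y+z]≡[x+z]+y (ballot n 1) (M C suc n) _ ⟩
      (ballot n 1 + M C suc (suc n)) + M C suc n  ≡⟨ cong (_+ M C suc n) ih ⟩
      M C suc n + M C suc n                       ≡⟨ cong (_+ M C suc n) ([m+n]Cm≡[m+n]Cn (suc n) n) ⟩
      M C n + M C suc n                           ≡⟨ nCk+nC[k+1]≡[n+1]C[k+1] M n ⟩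
      suc M C suc n                               ∎)
    where
    M = suc (n + n)
    top≡ : ∀ n → suc n + suc n + 0 ≡ suc (suc (n + n))
    top≡ = solve-∀
    ih : ballot n 1 + M C suc (suc n) ≡ M C suc n
    ih = subst₂ (λ T s → ballot n 1 + T C suc s ≡ T C s) (+-comm (n + n) 1) (+-comm n 1)
                (ballot[n,r]+[2n+r]C[1+n+r]≡[2n+r]C[n+r] n 1)
    x+[y+z]≡[x+z]+y : ∀ x y z → x + (y + z) ≡ (x + z) + y
    x+[y+z]≡[x+z]+y = solve-∀
  ballot[n,r]+[2n+r]C[1+n+r]≡[2n+r]C[n+r] (suc n) (suc r) =
    subst₂ (λ T s → B₁ + B₂ + T C suc s ≡ T C s) (sym (+-suc (suc n + suc n) r)) (cong suc (sym (+-suc n r))) (begin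
      (B₁ + B₂) + suc Q C suc (suc (suc s))
        ≡⟨ cong (B₁ + B₂ +_) (nCk+nC[k+1]≡[n+1]C[k+1] Q (suc (suc s))) ⟨
      (B₁ + B₂) + (Q C suc (suc s) + Q C suc (suc (suc s)))
        ≡⟨ interchange B₁ B₂ _ _ ⟩
      (B₁ + Q C suc (suc (suc s))) + (B₂ + Q C suc (suc s))
        ≡⟨ cong₂ _+_ ih (ballot[n,r]+[2n+r]C[1+n+r]≡[2n+r]C[n+r] (suc n) r) ⟩
      Q C suc (suc s) + Q C suc s
        ≡⟨ +-comm (Q C suc (suc s)) _ ⟩
      Q C suc s + Q C suc (suc s)
        ≡⟨ nCk+nC[k+1]≡[n+1]C[k+1] Q (suc s) ⟩
      suc Q C suc (suc s)
        ∎)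
    where
    B₁ = ballot n (suc (suc r))
    B₂ = ballot (suc n) r
    Q = suc n + suc n + r
    s = n + r
    top≡ : ∀ n r → n + n + suc (suc r) ≡ suc n + suc n + r
    top≡ = solve-∀
    ih : B₁ + Q C suc (suc (suc s)) ≡ Q C suc (suc s)
    ih = subst₂ (λ T s → B₁ + T C suc s ≡ T C s) (top≡ n r) (trans (+-suc n (suc r)) (cong suc (+-suc n r)))
                (ballot[n,r]+[2n+r]C[1+n+r]≡[2n+r]C[n+r] n (suc (suc r)))
    interchange : ∀ a b c d → (a + b) + (c + d) ≡ (a + d) + (b + c)
    interchange = solve-∀

  ballot[n,0]*[1+n]≡[2n]Cn : ∀ n → ballot n 0 * suc n ≡ (2 * n) C n
  ballot[n,0]*[1+n]≡[2n]Cn zero    = refl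
  ballot[n,0]*[1+n]≡[2n]Cn (suc m) =
    subst (λ T → B * suc (suc m) ≡ T C suc m) (sym (2[1+m]≡N m)) (+-cancelʳ-≡ (suc m * X) _ _ (begin
      B * suc (suc m) + suc m * X                        ≡⟨ cong (B * suc (suc m) +_) absorbed ⟨
      B * suc (suc m) + (N C suc (suc m)) * suc (suc m)  ≡⟨ *-distribʳ-+ (suc (suc m)) B _ ⟨
      (B + N C suc (suc m)) * suc (suc m)                ≡⟨ cong (_* suc (suc m)) ballot+C≡X ⟩
      X * suc (suc m)                                    ≡⟨ *-comm X (suc (suc m)) ⟩
      X + suc m * X                                      ∎))
    where
    B = ballot (suc m) 0
    M = suc (m + m)
    N = suc M
    X = N C suc m
    2[1+m]≡N : ∀ m → 2 * suc m ≡ suc (suc (m + m))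
    2[1+m]≡N = solve-∀
    ballot+C≡X : B + N C suc (suc m) ≡ X
    ballot+C≡X = subst₂ (λ T s → B + T C suc s ≡ T C s) (trans (+-identityʳ _) (cong suc (+-suc m m))) (+-identityʳ (suc m))
                        (ballot[n,r]+[2n+r]C[1+n+r]≡[2n+r]C[n+r] (suc m) 0)
    absorbed : (N C suc (suc m)) * suc (suc m) ≡ suc m * X
    absorbed = begin
      (N C suc (suc m)) * suc (suc m)  ≡⟨ *-comm (N C suc (suc m)) _ ⟩
      suc (suc m) * (N C suc (suc m))  ≡⟨ [1+k]*[1+n]C[1+k]≡[1+n]*nCk M (suc m) ⟩
      N * (M C suc m)                  ≡⟨ cong (N *_) ([m+n]Cm≡[m+n]Cn (suc m) m) ⟩
      N * (M C m)                      ≡⟨ [1+k]*[1+n]C[1+k]≡[1+n]*nCk M m ⟨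
      suc m * X                        ∎

module Staircases where

  open import Data.Nat
  open import Data.Nat.Properties
  open import Data.List using (List; []; _∷_; [_]; map; _++_; length; applyUpTo)
  open import Data.List.Properties using (length-map; length-++; ∷-injectiveʳ)
  open import Data.List.Membership.Propositional using (_∈_)
  open import Data.List.Membership.Propositional.Properties using (∈-map⁻; ∈-map⁺; ∈-++⁻; ∈-++⁺ˡ; ∈-++⁺ʳ)
  open import Data.List.Relation.Unary.All using ([])
  open import Data.List.Relation.Unary.AllPairs using ([]; _∷_)
  open import Data.List.Relation.Unary.Any using (here)
  open import Data.List.Relation.Unary.Unique.Propositional using (Unique)
  import Data.List.Relation.Unary.Unique.Propositional.Properties as Unique
  open import Data.Empty using (⊥-elim)
  open import Data.Sum using (inj₁; inj₂)
  open import Data.Product using (_×_; _,_)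
  open import Relation.Nullary using (¬_)
  open import Relation.Binary.PropositionalEquality hiding ([_])
  open BallotNumbers using (ballot)

  -- For top = floor = k these are the lists d₁ … d_{k-1}: entry j lies in [k ∸ j, previous entry].
  data Staircase : ℕ → ℕ → List ℕ → Set where
    []   : ∀ {top floor} → Staircase top floor []
    step : ∀ {top floor v s} → floor ≤ v → v ≤ top → Staircase v (pred floor) s → Staircase top floor (v ∷ s)

  staircase-≤-top : ∀ {top top′ floor s} → top ≤ top′ → Staircase top floor s → Staircase top′ floor s
  staircase-≤-top _      []                 = []
  staircase-≤-top top≤top′ (step f≤v v≤top s) = step f≤v (≤-trans v≤top top≤top′) s

  staircases : ℕ → ℕ → ℕ → List (List ℕ)
  staircases zero    top r       = [ [] ]
  staircases (suc n) top zero    = map (top ∷_) (staircases n top 1)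
  staircases (suc n) top (suc r) = map (top ∷_) (staircases n top (suc (suc r))) ++ staircases (suc n) (pred top) r

  length-staircases : ∀ n top r → length (staircases n top r) ≡ ballot n r
  length-staircases zero    top r       = refl
  length-staircases (suc n) top zero    = trans (length-map (top ∷_) (staircases n top 1)) (length-staircases n top 1)
  length-staircases (suc n) top (suc r) = begin
    length (map (top ∷_) (staircases n top (suc (suc r))) ++ staircases (suc n) (pred top) r)
      ≡⟨ length-++ (map (top ∷_) (staircases n top (suc (suc r)))) ⟩
    length (map (top ∷_) (staircases n top (suc (suc r)))) + length (staircases (suc n) (pred top) r)
      ≡⟨ cong₂ _+_ (length-map (top ∷_) (staircases n top (suc (suc r)))) (length-staircases (suc n) (pred top) r) ⟩
    length (staircases n top (suc (suc r))) + ballot (suc n) r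
      ≡⟨ cong (_+ ballot (suc n) r) (length-staircases n top (suc (suc r))) ⟩
    ballot n (suc (suc r)) + ballot (suc n) r
      ∎
    where open ≡-Reasoning

  pred[m]∸n≡m∸[1+n] : ∀ m n → pred m ∸ n ≡ m ∸ suc n
  pred[m]∸n≡m∸[1+n] zero    n = 0∸n≡0 n
  pred[m]∸n≡m∸[1+n] (suc m) n = refl

  private
    floor≡ : ∀ {v floor floor′ s} → floor ≡ floor′ → Staircase v floor s → Staircase v floor′ s
    floor≡ refl st = st

  ∈-staircases⁻ : ∀ n top r {s} → s ∈ staircases n top r → length s ≡ n × Staircase top (top ∸ r) s
  ∈-staircases⁻ zero top r (here refl) = refl , []
  ∈-staircases⁻ (suc n) top zero s∈ with ∈-map⁻ (top ∷_) s∈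
  ... | _ , s∈′ , refl with ∈-staircases⁻ n top 1 s∈′
  ... | len , st = cong suc len , step ≤-refl ≤-refl (floor≡ (sym (pred[m∸n]≡m∸[1+n] top 0)) st)
  ∈-staircases⁻ (suc n) top (suc r) s∈ with ∈-++⁻ (map (top ∷_) (staircases n top (suc (suc r)))) s∈
  ... | inj₁ s∈₁ with ∈-map⁻ (top ∷_) s∈₁
  ... | _ , s∈′ , refl with ∈-staircases⁻ n top (suc (suc r)) s∈′
  ... | len , st = cong suc len , step (m∸n≤m top (suc r)) ≤-refl (floor≡ (sym (pred[m∸n]≡m∸[1+n] top (suc r))) st)
  ∈-staircases⁻ (suc n) top (suc r) s∈ | inj₂ s∈₂ with ∈-staircases⁻ (suc n) (pred top) r s∈₂
  ... | len , st = len , staircase-≤-top pred[n]≤n (floor≡ (pred[m]∸n≡m∸[1+n] top r) st)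

  ∈-staircases⁺ : ∀ top r {s} → Staircase top (top ∸ r) s → s ∈ staircases (length s) top r
  ∈-staircases⁺-∷ : ∀ top r {v s} → top ∸ r ≤ v → v ≤ top → Staircase v (pred (top ∸ r)) s →
                    v ∷ s ∈ staircases (suc (length s)) top r

  ∈-staircases⁺ top r []                        = here refl
  ∈-staircases⁺ top r (step floor≤v v≤top rest) = ∈-staircases⁺-∷ top r floor≤v v≤top rest

  ∈-staircases⁺-∷ top r floor≤v v≤top rest with m≤n⇒m<n∨m≡n v≤top
  ∈-staircases⁺-∷ top zero    _ _ rest | inj₂ refl =
    ∈-map⁺ (top ∷_) (∈-staircases⁺ top 1 (floor≡ (pred[m∸n]≡m∸[1+n] top 0) rest))
  ∈-staircases⁺-∷ top (suc r) _ _ rest | inj₂ refl =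
    ∈-++⁺ˡ (∈-map⁺ (top ∷_) (∈-staircases⁺ top (suc (suc r)) (floor≡ (pred[m∸n]≡m∸[1+n] top (suc r)) rest)))
  ∈-staircases⁺-∷ top zero    floor≤v _ _ | inj₁ v<top = ⊥-elim (<⇒≱ v<top floor≤v)
  ∈-staircases⁺-∷ top (suc r) {v} {s} floor≤v _ rest | inj₁ v<top =
    ∈-++⁺ʳ (map (top ∷_) (staircases (length s) top (suc (suc r))))
      (∈-staircases⁺-∷ (pred top) r (subst (_≤ v) (sym pred[top]∸r) floor≤v) (<⇒≤pred v<top)
        (floor≡ (cong pred (sym pred[top]∸r)) rest))
    where pred[top]∸r = pred[m]∸n≡m∸[1+n] top r

  staircases-unique : ∀ n top r → n + r < top → Unique (staircases n top r)
  staircases-unique zero    top r       _       = [] ∷ []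
  staircases-unique (suc n) top zero    n+r<top =
    Unique.map⁺ ∷-injectiveʳ (staircases-unique n top 1 (subst (_< top) (sym (+-suc n 0)) n+r<top))
  staircases-unique (suc n) top (suc r) n+r<top =
    Unique.++⁺ (Unique.map⁺ ∷-injectiveʳ (staircases-unique n top (suc (suc r)) (subst (_< top) (sym (+-suc n (suc r))) n+r<top)))
               (staircases-unique (suc n) (pred top) r (pred-mono-< (subst (_< top) (+-suc (suc n) r) n+r<top)))
               disjoint
    where
    instance
      _ = >-nonZero (<-≤-trans z<s n+r<top)
    disjoint : ∀ {s} → ¬ (s ∈ map (top ∷_) (staircases n top (suc (suc r))) × s ∈ staircases (suc n) (pred top) r)
    disjoint (s∈₁ , s∈₂) with ∈-map⁻ (top ∷_) s∈₁
    ... | _ , _ , refl with ∈-staircases⁻ (suc n) (pred top) r s∈₂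
    ... | _ , step _ top≤pred[top] _ = <-irrefl refl (m≤pred[n]⇒suc[m]≤n top≤pred[top])

  entry : List ℕ → ℕ → ℕ
  entry []      _       = 0
  entry (v ∷ _) zero    = v
  entry (_ ∷ s) (suc i) = entry s i

  entry-applyUpTo : ∀ f {n i} → i < n → entry (applyUpTo f n) i ≡ f i
  entry-applyUpTo f {suc n} {zero}  _   = refl
  entry-applyUpTo f {suc n} {suc i} i<n = entry-applyUpTo (λ j → f (suc j)) (s≤s⁻¹ i<n)

  entry-ext : ∀ {s t} → length s ≡ length t → (∀ {i} → i < length s → entry s i ≡ entry t i) → s ≡ t
  entry-ext {[]}    {[]}    _   _    = refl
  entry-ext {v ∷ s} {w ∷ t} len same =
    cong₂ _∷_ (same z<s) (entry-ext (suc-injective len) (λ i<len → same (s≤s i<len)))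

  staircase-antitone : ∀ {top floor s i} → Staircase top floor s → i < length s →
                       entry (top ∷ s) (suc i) ≤ entry (top ∷ s) i
  staircase-antitone {i = zero}  (step _ v≤top _) _     = v≤top
  staircase-antitone {i = suc i} (step _ _ rest)  i<len = staircase-antitone rest (s≤s⁻¹ i<len)

  staircase-floor : ∀ {top floor s i} → Staircase top floor s → i < length s → floor ∸ i ≤ entry s i
  staircase-floor {i = zero}  (step floor≤v _ _) _ = floor≤v
  staircase-floor {floor = floor} {_ ∷ s} {suc i} (step _ _ rest) i<len =
    subst (_≤ entry s i) (pred[m]∸n≡m∸[1+n] floor i) (staircase-floor rest (s≤s⁻¹ i<len))

  applyUpTo-staircase : ∀ f {n top floor} → (∀ {i} → suc i < n → f (suc i) ≤ f i) → (0 < n → f 0 ≤ top) →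
                        (∀ {i} → i < n → floor ∸ i ≤ f i) → Staircase top floor (applyUpTo f n)
  applyUpTo-staircase f {zero}  _        _      _     = []
  applyUpTo-staircase f {suc n} {floor = floor} antitone f0≤top above =
    step (above z<s) (f0≤top z<s)
         (applyUpTo-staircase (λ i → f (suc i)) (λ i+1<n → antitone (s≤s i+1<n)) (λ 0<n → antitone (s≤s 0<n))
           (λ {i} i<n → subst (_≤ f (suc i)) (sym (pred[m]∸n≡m∸[1+n] floor i)) (above (s≤s i<n))))

module Admissibility where

  open import Data.Nat
  open import Data.Nat.Properties
  open import Data.List using (_∷_; length; applyUpTo)
  open import Data.Sum using (inj₁; inj₂)
  open import Relation.Binary.PropositionalEquality
  open Staircases

  record Admissible (k : ℕ) (d : ℕ → ℕ) : Set where
    field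
      d0≡k           : d 0 ≡ k
      antitone       : ∀ {i} → suc i < k → d (suc i) ≤ d i
      above-diagonal : ∀ {i} → suc i < k → k < d (suc i) + suc i

    antitone-≤ : ∀ {i j} → i ≤ j → j < k → d j ≤ d i
    antitone-≤ {i} {j} i≤j j<k with m≤n⇒m<n∨m≡n i≤j
    ... | inj₂ refl = ≤-refl
    antitone-≤ {i} {suc j} _ 1+j<k | inj₁ i<1+j =
      ≤-trans (antitone 1+j<k) (antitone-≤ (s≤s⁻¹ i<1+j) (<-trans (n<1+n j) 1+j<k))

    d≤k : ∀ {i} → i < k → d i ≤ k
    d≤k i<k = subst (d _ ≤_) d0≡k (antitone-≤ z≤n i<k)

    k≤d+i : ∀ {i} → i < k → k ≤ d i + i
    k≤d+i {zero}  _   = ≤-reflexive (sym (trans (+-identityʳ (d 0)) d0≡k))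
    k≤d+i {suc i} i<k = <⇒≤ (above-diagonal i<k)

    0<d : ∀ {i} → i < k → 0 < d i
    0<d {i} i<k = n≢0⇒n>0 (λ di≡0 → <⇒≱ i<k (subst (λ v → k ≤ v + i) di≡0 (k≤d+i i<k)))

  m∸n≤o⇒m<o+[1+n] : ∀ {m n o} → n ≤ m → m ∸ n ≤ o → m < o + suc n
  m∸n≤o⇒m<o+[1+n] {m} {n} {o} n≤m m∸n≤o = begin-strict
    m            ≡⟨ m∸n+n≡m n≤m ⟨
    m ∸ n + n    ≤⟨ +-monoˡ-≤ n m∸n≤o ⟩
    o + n        <⟨ n<1+n _ ⟩
    suc (o + n)  ≡⟨ +-suc o n ⟨
    o + suc n    ∎
    where open ≤-Reasoning

  m<o+[1+n]⇒m∸n≤o : ∀ {m n o} → m < o + suc n → m ∸ n ≤ o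
  m<o+[1+n]⇒m∸n≤o {m} {n} {o} m<o+1+n =
    m≤n+o⇒m∸n≤o m n (subst (m ≤_) (+-comm o n) (s≤s⁻¹ (subst (m <_) (+-suc o n) m<o+1+n)))

  staircase⇒admissible : ∀ {k-1 t} → Staircase (suc k-1) (suc k-1) t → length t ≡ k-1 →
                         Admissible (suc k-1) (entry (suc k-1 ∷ t))
  staircase⇒admissible {k-1} {t} st len = record
    { d0≡k           = refl
    ; antitone       = λ i+1<k → staircase-antitone st (i<len i+1<k)
    ; above-diagonal = λ i+1<k → m∸n≤o⇒m<o+[1+n] (<⇒≤ (m<n⇒m<1+n (s≤s⁻¹ i+1<k))) (staircase-floor st (i<len i+1<k))
    }
    where
    i<len : ∀ {i} → suc i < suc k-1 → i < length t
    i<len i+1<k = subst (_ <_) (sym len) (s≤s⁻¹ i+1<k)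

  admissible⇒staircase : ∀ {k-1 d} → Admissible (suc k-1) d →
                         Staircase (suc k-1) (suc k-1) (applyUpTo (λ i → d (suc i)) k-1)
  admissible⇒staircase {k-1} {d} admissible =
    applyUpTo-staircase (λ i → d (suc i)) (λ i+1<k-1 → antitone (s≤s i+1<k-1)) (λ 0<k-1 → d≤k (s≤s 0<k-1))
      (λ i<k-1 → m<o+[1+n]⇒m∸n≤o (above-diagonal (s≤s i<k-1)))
    where open Admissible admissible

module Rationals where

  open import Data.Nat as ℕ using (suc)
  import Data.Nat.GCD as ℕ
  open import Data.Integer as ℤ using (ℤ; +_; -[1+_])
  import Data.Integer.Properties as ℤ
  open import Data.Rational
  open import Data.Rational.Properties
  open import Data.Rational.Solver using (module +-*-Solver)
  open import Data.List using ([]; _∷_)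
  open import Data.List.Relation.Unary.Any using (here; there)
  open import Data.Product using (∃; _×_; _,_)
  open import Data.Sum using (inj₁; inj₂)
  open import Data.Empty using (⊥-elim)
  open import Relation.Binary.PropositionalEquality
  open import Relation.Binary.Definitions using (tri<; tri≈; tri>)
  open import Relation.Nullary using (¬_; yes; no)
  open +-*-Solver

  <⇒≱ : ∀ {p q} → p < q → ¬ q ≤ p
  <⇒≱ p<q q≤p = <-irrefl refl (<-≤-trans p<q q≤p)

  p≤q⇒0≤q-p : ∀ {p q} → p ≤ q → 0ℚ ≤ q - p
  p≤q⇒0≤q-p {p} {q} p≤q = subst (_≤ q - p) (+-inverseʳ p) (+-monoˡ-≤ (- p) p≤q)

  p<q⇒0<q-p : ∀ {p q} → p < q → 0ℚ < q - p
  p<q⇒0<q-p {p} {q} p<q = subst (_< q - p) (+-inverseʳ p) (+-monoˡ-< (- p) p<q)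

  0<q-p⇒p<q : ∀ {p q} → 0ℚ < q - p → p < q
  0<q-p⇒p<q {p} {q} 0<q-p = subst₂ _<_ (+-identityˡ p) (q-p+p≡q p q) (+-monoˡ-< p 0<q-p)
    where
    q-p+p≡q : ∀ p q → q - p + p ≡ q
    q-p+p≡q = solve 2 (λ p q → q :- p :+ p := q) refl

  <-by-difference : ∀ {p q r s} → p < q → q - p ≡ s - r → r < s
  <-by-difference p<q eq = 0<q-p⇒p<q (subst (0ℚ <_) eq (p<q⇒0<q-p p<q))

  p+[q-p]≡q : ∀ p q → p + (q - p) ≡ q
  p+[q-p]≡q = solve 2 (λ p q → p :+ (q :- p) := q) refl

  p<q+r⇒p-r<q : ∀ {p q r} → p < q + r → p - r < q
  p<q+r⇒p-r<q {p} {q} {r} h = <-by-difference h (solve 3 (λ p q r → q :+ r :- p := q :- (p :- r)) refl p q r)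

  p-r<q⇒p<q+r : ∀ {p q r} → p - r < q → p < q + r
  p-r<q⇒p<q+r {p} {q} {r} h = <-by-difference h (solve 3 (λ p q r → q :- (p :- r) := q :+ r :- p) refl p q r)

  q-r<p⇒q-p<r : ∀ {p q r} → q - r < p → q - p < r
  q-r<p⇒q-p<r {p} {q} {r} h = <-by-difference h (solve 3 (λ p q r → p :- (q :- r) := r :- (q :- p)) refl p q r)

  p≤q⇒p<q+r : ∀ {p q r} → p ≤ q → 0ℚ < r → p < q + r
  p≤q⇒p<q+r {p} {q} {r} p≤q 0<r = subst (_< q + r) (+-identityʳ p) (+-mono-≤-< p≤q 0<r)

  0<r⇒p<p+r : ∀ p {r} → 0ℚ < r → p < p + r
  0<r⇒p<p+r p = p≤q⇒p<q+r ≤-refl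

  0<r⇒p-r<p : ∀ p {r} → 0ℚ < r → p - r < p
  0<r⇒p-r<p p 0<r = p<q+r⇒p-r<q (0<r⇒p<p+r p 0<r)

  <-⊓ : ∀ {p q r} → r < p → r < q → r < p ⊓ q
  <-⊓ {p} {q} r<p r<q with ⊓-sel p q
  ... | inj₁ p⊓q≡p = subst (_ <_) (sym p⊓q≡p) r<p
  ... | inj₂ p⊓q≡q = subst (_ <_) (sym p⊓q≡q) r<q

  ⊔-< : ∀ {p q r} → p < r → q < r → p ⊔ q < r
  ⊔-< {p} {q} p<r q<r with ⊔-sel p q
  ... | inj₁ p⊔q≡p = subst (_< _) (sym p⊔q≡p) p<r
  ... | inj₂ p⊔q≡q = subst (_< _) (sym p⊔q≡q) q<r

  p≤∣p∣ : ∀ p → p ≤ ∣ p ∣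
  p≤∣p∣ p with ≤-total 0ℚ p
  ... | inj₁ 0≤p = ≤-reflexive (sym (0≤p⇒∣p∣≡p 0≤p))
  ... | inj₂ p≤0 = ≤-trans p≤0 (0≤∣p∣ p)

  q-p≤∣p-q∣ : ∀ p q → q - p ≤ ∣ p - q ∣
  q-p≤∣p-q∣ p q = subst₂ _≤_ (-[p-q]≡q-p p q) (∣-p∣≡∣p∣ (p - q)) (p≤∣p∣ (- (p - q)))
    where
    -[p-q]≡q-p : ∀ p q → - (p - q) ≡ q - p
    -[p-q]≡q-p = solve 2 (λ p q → :- (p :- q) := q :- p) refl

  ∣p-q∣<q-r⇒r<p : ∀ {p q r} → ∣ p - q ∣ < q - r → r < p
  ∣p-q∣<q-r⇒r<p {p} {q} {r} h = <-by-difference (≤-<-trans (q-p≤∣p-q∣ p q) h)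
    (solve 3 (λ p q r → q :- r :- (q :- p) := p :- r) refl p q r)

  p≤q⇒∣p-q∣≡q-p : ∀ {p q} → p ≤ q → ∣ p - q ∣ ≡ q - p
  p≤q⇒∣p-q∣≡q-p {p} {q} p≤q = begin
    ∣ p - q ∣       ≡⟨ cong ∣_∣ (p-q≡-[q-p] p q) ⟩
    ∣ - (q - p) ∣   ≡⟨ ∣-p∣≡∣p∣ (q - p) ⟩
    ∣ q - p ∣       ≡⟨ 0≤p⇒∣p∣≡p (p≤q⇒0≤q-p p≤q) ⟩
    q - p           ∎
    where
    open ≡-Reasoning
    p-q≡-[q-p] : ∀ p q → p - q ≡ - (q - p)
    p-q≡-[q-p] = solve 2 (λ p q → p :- q := :- (q :- p)) refl

  p-q≡0⇒p≡q : ∀ {p q} → p - q ≡ 0ℚ → p ≡ q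
  p-q≡0⇒p≡q {p} {q} p-q≡0 = begin
    p          ≡⟨ p-q+q≡p p q ⟨
    p - q + q  ≡⟨ cong (_+ q) p-q≡0 ⟩
    0ℚ + q     ≡⟨ +-identityˡ q ⟩
    q          ∎
    where
    open ≡-Reasoning
    p-q+q≡p : ∀ p q → p - q + q ≡ p
    p-q+q≡p = solve 2 (λ p q → p :- q :+ q := p) refl

  p≢q⇒0<∣p-q∣ : ∀ {p q} → p ≢ q → 0ℚ < ∣ p - q ∣
  p≢q⇒0<∣p-q∣ {p} {q} p≢q with <-cmp 0ℚ ∣ p - q ∣
  ... | tri< 0<∣p-q∣ _ _ = 0<∣p-q∣
  ... | tri≈ _ 0≡∣p-q∣ _ = ⊥-elim (p≢q (p-q≡0⇒p≡q (∣p∣≡0⇒p≡0 (p - q) (sym 0≡∣p-q∣))))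
  ... | tri> _ _ ∣p-q∣<0 = ⊥-elim (<⇒≱ ∣p-q∣<0 (0≤∣p∣ (p - q)))

  affine-equal⇒slope≡0 : ∀ {m b x₁ x₂} → x₁ < x₂ → m * x₁ + b ≡ m * x₂ + b → m ≡ 0ℚ
  affine-equal⇒slope≡0 {m} {b} x₁<x₂ eq with <-cmp m 0ℚ
  ... | tri< m<0 _ _ = ⊥-elim (<-irrefl (sym eq) (+-monoˡ-< b (*-monoʳ-<-neg m {{negative m<0}} x₁<x₂)))
  ... | tri≈ _ m≡0 _ = m≡0
  ... | tri> _ _ 0<m = ⊥-elim (<-irrefl eq (+-monoˡ-< b (*-monoʳ-<-pos m {{positive 0<m}} x₁<x₂)))

  break-free-subinterval : ∀ ts {lo hi} → lo < hi →
    ∃ λ a → ∃ λ b → lo < a × a < b × b < hi × NoBreakIn ts a b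
  break-free-subinterval [] lo<hi with <-dense lo<hi
  ... | a , lo<a , a<hi with <-dense a<hi
  ... | b , a<b , b<hi = a , b , lo<a , a<b , b<hi , λ _ ()
  break-free-subinterval (t ∷ ts) lo<hi with break-free-subinterval ts lo<hi
  ... | a , b , lo<a , a<b , b<hi , free with <-dense a<b
  ... | m , a<m , m<b with t <? m
  ...   | yes t<m = m , b , <-trans lo<a a<m , m<b , b<hi , free′
    where
    free′ : NoBreakIn (t ∷ ts) m b
    free′ _ (here refl)  (m≤t , _)   = <⇒≱ t<m m≤t
    free′ u (there u∈ts) (m≤u , u≤b) = free u u∈ts (≤-trans (<⇒≤ a<m) m≤u , u≤b)
  ...   | no t≮m with <-dense a<m
  ...     | m′ , a<m′ , m′<m = a , m′ , lo<a , a<m′ , <-trans (<-trans m′<m m<b) b<hi , free′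
    where
    free′ : NoBreakIn (t ∷ ts) a m′
    free′ _ (here refl)  (_ , t≤m′)   = t≮m (≤-<-trans t≤m′ m′<m)
    free′ u (there u∈ts) (a≤u , u≤m′) = free u u∈ts (a≤u , ≤-trans u≤m′ (<⇒≤ (<-trans m′<m m<b)))

  ↥[z/1]≡z : ∀ z → ↥ (z / 1) ≡ z
  ↥[z/1]≡z z = begin
    ↥ (z / 1)                           ≡⟨ ℤ.*-identityʳ (↥ (z / 1)) ⟨
    ↥ (z / 1) ℤ.* + 1                   ≡⟨ cong (λ g → ↥ (z / 1) ℤ.* + g) (ℕ.gcd-zeroʳ ℤ.∣ z ∣) ⟨
    ↥ (z / 1) ℤ.* + ℕ.gcd ℤ.∣ z ∣ 1     ≡⟨ ↥-/ z 1 ⟩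
    z                                   ∎
    where open ≡-Reasoning

  0≤z/1⇒z≡+∣z∣ : ∀ z → 0ℚ ≤ z / 1 → z ≡ + ℤ.∣ z ∣
  0≤z/1⇒z≡+∣z∣ (+ n)    _   = refl
  0≤z/1⇒z≡+∣z∣ -[1+ n ] 0≤z = ⊥-elim (<⇒≱ (negative⁻¹ _) 0≤z)
    where instance _ = neg-pos {normalize (suc n) 1} (normalize-pos (suc n) 1)

module Analysis where

  open import Data.Rational
  open import Data.Rational.Properties
  open import Data.Product using (∃; _×_; _,_; proj₁; proj₂)
  open import Data.Sum using (inj₁; inj₂)
  open import Data.Empty using (⊥-elim)
  open import Relation.Binary.PropositionalEquality
  open import Relation.Nullary using (yes; no)
  open import Function using (_∘_)
  open Rationals

  PiecewiseConstant⇒PiecewiseLinear : ∀ {f} → PiecewiseConstant f → PiecewiseLinear f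
  PiecewiseConstant⇒PiecewiseLinear {f} (ts , const) = ts , λ x y z 0≤x x<y y<z z≤1 free →
    let fx≡fy = const x y 0≤x x<y (≤-trans (<⇒≤ y<z) z≤1)
                  (λ t t∈ (x≤t , t≤y) → free t t∈ (x≤t , ≤-trans t≤y (<⇒≤ y<z)))
        fx≡fz = const x z 0≤x (<-trans x<y y<z) z≤1 free
    in begin
      (f y - f x) * (z - x)  ≡⟨ cong (λ v → (v - f x) * (z - x)) (sym fx≡fy) ⟩
      (f x - f x) * (z - x)  ≡⟨ cong (_* (z - x)) (+-inverseʳ (f x)) ⟩
      0ℚ * (z - x)           ≡⟨ *-zeroˡ (z - x) ⟩
      0ℚ                     ≡⟨ *-zeroˡ (y - x) ⟨
      0ℚ * (y - x)           ≡⟨ cong (_* (y - x)) (+-inverseʳ (f x)) ⟨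
      (f x - f x) * (y - x)  ≡⟨ cong (λ v → (v - f x) * (y - x)) fx≡fz ⟩
      (f z - f x) * (y - x)  ∎
    where open ≡-Reasoning

  PiecewiseConstant∧affine⇒constant : ∀ {f lo hi m b} → PiecewiseConstant f → 0ℚ ≤ lo → lo < hi → hi ≤ 1ℚ →
    (∀ x → lo < x → x < hi → f x ≡ m * x + b) → ∀ x → lo < x → x < hi → f x ≡ b
  PiecewiseConstant∧affine⇒constant {f} {lo} {hi} {m} {b} (ts , const) 0≤lo lo<hi hi≤1 affine x lo<x x<hi =
    let x₁ , x₂ , lo<x₁ , x₁<x₂ , x₂<hi , no-break = break-free-subinterval ts lo<hi
        fx₁≡fx₂ = const x₁ x₂ (≤-trans 0≤lo (<⇒≤ lo<x₁)) x₁<x₂ (≤-trans (<⇒≤ x₂<hi) hi≤1) no-break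
        m≡0 = affine-equal⇒slope≡0 {m} {b} x₁<x₂ (trans (sym (affine x₁ lo<x₁ (<-trans x₁<x₂ x₂<hi)))
                                                  (trans fx₁≡fx₂ (affine x₂ (<-trans lo<x₁ x₁<x₂) x₂<hi)))
    in begin
      f x          ≡⟨ affine x lo<x x<hi ⟩
      m * x + b    ≡⟨ cong (λ s → s * x + b) m≡0 ⟩
      0ℚ * x + b   ≡⟨ cong (_+ b) (*-zeroˡ x) ⟩
      0ℚ + b       ≡⟨ +-identityˡ b ⟩
      b            ∎
    where open ≡-Reasoning

  const⇒RightLimit : ∀ {f a b c} → a < b → (∀ x → a < x → x < b → f x ≡ c) → RightLimit f a c
  const⇒RightLimit {f} {a} {b} {c} a<b const η 0<η = b - a , p<q⇒0<q-p a<b , close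
    where
    close : ∀ x → a < x → x < a + (b - a) → x ≤ 1ℚ → ∣ f x - c ∣ < η
    close x a<x x<a+[b-a] _ = subst (λ w → ∣ w - c ∣ < η) (sym (const x a<x x<b)) ∣c-c∣<η
      where
      x<b = subst (x <_) (p+[q-p]≡q a b) x<a+[b-a]
      ∣c-c∣<η = subst (λ w → ∣ w ∣ < η) (sym (+-inverseʳ c)) 0<η

  -- If c ≢ v, the tolerance η = ∣ v - c ∣ is violated by the points right of a where f = v.
  RightLimit-const⇒≡ : ∀ {f a b c v} → a < b → b ≤ 1ℚ → (∀ x → a < x → x < b → f x ≡ v) →
                       RightLimit f a c → c ≡ v
  RightLimit-const⇒≡ {f} {a} {b} {c} {v} a<b b≤1 const lim with c ≟ v
  ... | yes c≡v = c≡v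
  ... | no c≢v with lim ∣ v - c ∣ (p≢q⇒0<∣p-q∣ (c≢v ∘ sym))
  ...   | δ , 0<δ , close with <-dense (<-⊓ a<b (0<r⇒p<p+r a 0<δ))
  ...     | x , a<x , x<b⊓a+δ = ⊥-elim (<-irrefl refl (subst (λ w → ∣ w - c ∣ < ∣ v - c ∣) fx≡v
                                   (close x a<x (<-≤-trans x<b⊓a+δ (p⊓q≤q b _)) (≤-trans (<⇒≤ x<b) b≤1))))
    where
    x<b = <-≤-trans x<b⊓a+δ (p⊓q≤p b _)
    fx≡v = const x a<x x<b

  left-constant⇒UpperSemicontinuous : ∀ {f} → WeaklyDecreasing f →
    (∀ x → In01 x → ∃ λ l → l < x × ∀ y → In01 y → l < y → y ≤ x → f y ≡ f x) →
    UpperSemicontinuous f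
  left-constant⇒UpperSemicontinuous {f} decreasing left-constant x x∈ η 0<η with left-constant x x∈
  ... | l , l<x , const = x - l , p<q⇒0<q-p l<x , λ y y∈ ∣y-x∣<x-l → p≤q⇒p<q+r (fy≤fx y y∈ ∣y-x∣<x-l) 0<η
    where
    fy≤fx : ∀ y → In01 y → ∣ y - x ∣ < x - l → f y ≤ f x
    fy≤fx y y∈ ∣y-x∣<x-l with ≤-total x y
    ... | inj₁ x≤y = decreasing x y x∈ y∈ x≤y
    ... | inj₂ y≤x = ≤-reflexive (const y y∈ (∣p-q∣<q-r⇒r<p ∣y-x∣<x-l) y≤x)

  UpperSemicontinuous⇒right-end-≡ : ∀ {f lo hi b} → UpperSemicontinuous f → WeaklyDecreasing f →
    In01 lo → In01 hi → lo < hi → (∀ x → lo < x → x < hi → f x ≡ b) → f hi ≡ b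
  UpperSemicontinuous⇒right-end-≡ {f} {lo} {hi} {b} usc decreasing (0≤lo , _) hi∈@(_ , hi≤1) lo<hi const =
    ≤-antisym fhi≤b (≮⇒≥ fhi≮b)
    where
    inside : ∀ {y} → lo < y → y < hi → In01 y
    inside lo<y y<hi = ≤-trans 0≤lo (<⇒≤ lo<y) , ≤-trans (<⇒≤ y<hi) hi≤1
    fhi≤b : f hi ≤ b
    fhi≤b = let m , lo<m , m<hi = <-dense lo<hi in
      subst (f hi ≤_) (const m lo<m m<hi) (decreasing m hi (inside lo<m m<hi) hi∈ (<⇒≤ m<hi))
    -- Upper semicontinuity at hi with η = b - f hi would make f < b just left of hi.
    fhi≮b : f hi ≮ b
    fhi≮b fhi<b = <-irrefl (const y lo<y y<hi) (subst (f y <_) (p+[q-p]≡q (f hi) b) fy<)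
      where
      δ,close = usc hi hi∈ (b - f hi) (p<q⇒0<q-p fhi<b)
      δ = proj₁ δ,close
      y,between = <-dense (⊔-< lo<hi (0<r⇒p-r<p hi (proj₁ (proj₂ δ,close))))
      y = proj₁ y,between
      lo⊔[hi-δ]<y = proj₁ (proj₂ y,between)
      y<hi = proj₂ (proj₂ y,between)
      lo<y = ≤-<-trans (p≤p⊔q lo _) lo⊔[hi-δ]<y
      ∣y-hi∣<δ : ∣ y - hi ∣ < δ
      ∣y-hi∣<δ = subst (_< δ) (sym (p≤q⇒∣p-q∣≡q-p (<⇒≤ y<hi)))
                   (q-r<p⇒q-p<r {y} {hi} {δ} (≤-<-trans (p≤q⊔p lo (hi - δ)) lo⊔[hi-δ]<y))
      fy< : f y < f hi + (b - f hi)
      fy< = proj₂ (proj₂ δ,close) y (inside lo<y y<hi) ∣y-hi∣<δ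

module Grid (k-1 : ℕ) where

  open import Data.Nat as ℕ using (zero; suc)
  import Data.Nat.Properties as ℕ
  open import Data.Integer as ℤ using (ℤ; +_)
  import Data.Integer.Properties as ℤ
  open import Data.Integer.Tactic.RingSolver using (solve-∀)
  open import Data.Rational
  open import Data.Rational.Properties
  import Data.Rational.Unnormalised as ℚᵘ
  import Data.Rational.Unnormalised.Properties as ℚᵘ
  open import Data.Empty using (⊥-elim)
  open import Data.Sum using (inj₁; inj₂)
  open import Data.Product using (_,_)
  open import Relation.Binary.PropositionalEquality
  open import Relation.Nullary using (yes; no)
  open Rationals

  k : ℕ
  k = suc k-1

  -- Opaque, so that unification treats grid i as rigid instead of unfolding the normalisation of i/k.
  opaque
    grid : ℕ → ℚ
    grid i = frac i k

    grid≡frac : ∀ i → grid i ≡ frac i k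
    grid≡frac i = refl

    private
      toℚᵘ-grid : ∀ i → toℚᵘ (grid i) ℚᵘ.≃ ℚᵘ.mkℚᵘ (+ i) k-1
      toℚᵘ-grid i = toℚᵘ-fromℚᵘ (ℚᵘ.mkℚᵘ (+ i) k-1)

    grid-0 : grid 0 ≡ 0ℚ
    grid-0 = 0/n≡0 k

    0≤grid : ∀ i → 0ℚ ≤ grid i
    0≤grid i = nonNegative⁻¹ _ {{normalize-nonNeg i k}}

    0<grid : ∀ {i} → 0 ℕ.< i → 0ℚ < grid i
    0<grid {suc i} _ = positive⁻¹ _ {{normalize-pos (suc i) k}}

  grid-+ : ∀ i j → grid i + grid j ≡ grid (i ℕ.+ j)
  grid-+ i j = toℚᵘ-injective (ℚᵘ.≃-trans (toℚᵘ-homo-+ (grid i) (grid j))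
                 (ℚᵘ.≃-trans (ℚᵘ.+-cong (toℚᵘ-grid i) (toℚᵘ-grid j))
                 (ℚᵘ.≃-trans (ℚᵘ.*≡* numerators) (ℚᵘ.≃-sym (toℚᵘ-grid (i ℕ.+ j))))))
    where
    common-denominator : ∀ (a b c : ℤ) → (a ℤ.* c ℤ.+ b ℤ.* c) ℤ.* c ≡ (a ℤ.+ b) ℤ.* (c ℤ.* c)
    common-denominator = solve-∀
    numerators : (+ i ℤ.* + k ℤ.+ + j ℤ.* + k) ℤ.* + k ≡ + (i ℕ.+ j) ℤ.* + (k ℕ.* k)
    numerators = trans (common-denominator (+ i) (+ j) (+ k)) (cong₂ ℤ._*_ (sym (ℤ.pos-+ i j)) (sym (ℤ.pos-* k k)))

  grid-k : grid k ≡ 1ℚ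
  grid-k = toℚᵘ-injective
    (ℚᵘ.≃-trans (toℚᵘ-grid k) (ℚᵘ.*≡* (trans (ℤ.*-identityʳ (+ k)) (sym (ℤ.*-identityˡ (+ k))))))

  grid-mono-≤ : ∀ {i j} → i ℕ.≤ j → grid i ≤ grid j
  grid-mono-≤ {i} {j} i≤j = begin
    grid i                   ≡⟨ +-identityʳ (grid i) ⟨
    grid i + 0ℚ              ≤⟨ +-monoʳ-≤ (grid i) (0≤grid (j ℕ.∸ i)) ⟩
    grid i + grid (j ℕ.∸ i)  ≡⟨ grid-+ i (j ℕ.∸ i) ⟩
    grid (i ℕ.+ (j ℕ.∸ i))   ≡⟨ cong grid (ℕ.m+[n∸m]≡n i≤j) ⟩
    grid j                   ∎
    where open ≤-Reasoning

  grid-mono-< : ∀ {i j} → i ℕ.< j → grid i < grid j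
  grid-mono-< {i} {j} i<j = begin-strict
    grid i                   ≡⟨ +-identityʳ (grid i) ⟨
    grid i + 0ℚ              <⟨ +-monoʳ-< (grid i) (0<grid (ℕ.m<n⇒0<n∸m i<j)) ⟩
    grid i + grid (j ℕ.∸ i)  ≡⟨ grid-+ i (j ℕ.∸ i) ⟩
    grid (i ℕ.+ (j ℕ.∸ i))   ≡⟨ cong grid (ℕ.m+[n∸m]≡n (ℕ.<⇒≤ i<j)) ⟩
    grid j                   ∎
    where open ≤-Reasoning

  grid-cancel-≤ : ∀ {i j} → grid i ≤ grid j → i ℕ.≤ j
  grid-cancel-≤ gi≤gj = ℕ.≮⇒≥ (λ j<i → <⇒≱ (grid-mono-< j<i) gi≤gj)

  grid-cancel-< : ∀ {i j} → grid i < grid j → i ℕ.< j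
  grid-cancel-< gi<gj = ℕ.≰⇒> (λ j≤i → <⇒≱ gi<gj (grid-mono-≤ j≤i))

  grid-injective : ∀ {i j} → grid i ≡ grid j → i ≡ j
  grid-injective gi≡gj = ℕ.≤-antisym (grid-cancel-≤ (≤-reflexive gi≡gj)) (grid-cancel-≤ (≤-reflexive (sym gi≡gj)))

  grid∈[0,1] : ∀ {i} → i ℕ.≤ k → In01 (grid i)
  grid∈[0,1] i≤k = 0≤grid _ , subst (grid _ ≤_) grid-k (grid-mono-≤ i≤k)

  k/1 : ℚ
  k/1 = + k / 1

  k/1*grid : ∀ i → k/1 * grid i ≡ + i / 1
  k/1*grid i = toℚᵘ-injective (ℚᵘ.≃-trans (toℚᵘ-homo-* k/1 (grid i))
                 (ℚᵘ.≃-trans (ℚᵘ.*-cong (toℚᵘ-fromℚᵘ (ℚᵘ.mkℚᵘ (+ k) 0)) (toℚᵘ-grid i))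
                 (ℚᵘ.≃-trans (ℚᵘ.*≡* cross) (ℚᵘ.≃-sym (toℚᵘ-fromℚᵘ (ℚᵘ.mkℚᵘ (+ i) 0))))))
    where
    reorder : ∀ (a b : ℤ) → a ℤ.* b ℤ.* + 1 ≡ b ℤ.* (+ 1 ℤ.* a)
    reorder = solve-∀
    cross : (+ k ℤ.* + i) ℤ.* + 1 ≡ + i ℤ.* + (1 ℕ.* k)
    cross = trans (reorder (+ k) (+ i)) (cong (+ i ℤ.*_) (sym (ℤ.pos-* 1 k)))

  k/1*-cancel : ∀ {p q} → k/1 * p ≡ k/1 * q → p ≡ q
  k/1*-cancel eq = ≤-antisym (*-cancelˡ-≤-pos k/1 (≤-reflexive eq)) (*-cancelˡ-≤-pos k/1 (≤-reflexive (sym eq)))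
    where instance _ = normalize-pos k 1

  integral⇒grid : ∀ {v z} → 0ℚ ≤ v → k/1 * v ≡ ℤ→ℚ z → v ≡ grid ℤ.∣ ↥ (k/1 * v) ∣
  integral⇒grid {v} {z} 0≤v kv≡z = k/1*-cancel (begin
    k/1 * v                       ≡⟨ kv≡z ⟩
    z / 1                         ≡⟨ cong (_/ 1) z≡∣↥kv∣ ⟩
    + ℤ.∣ ↥ (k/1 * v) ∣ / 1       ≡⟨ k/1*grid ℤ.∣ ↥ (k/1 * v) ∣ ⟨
    k/1 * grid ℤ.∣ ↥ (k/1 * v) ∣  ∎)
    where
    open ≡-Reasoning
    instance
      _ = normalize-nonNeg k 1
      _ = nonNegative 0≤v
    0≤z/1 : 0ℚ ≤ z / 1
    0≤z/1 = subst (0ℚ ≤_) kv≡z (nonNegative⁻¹ _ {{nonNeg*nonNeg⇒nonNeg k/1 v}})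
    z≡∣↥kv∣ : z ≡ + ℤ.∣ ↥ (k/1 * v) ∣
    z≡∣↥kv∣ = trans (0≤z/1⇒z≡+∣z∣ z 0≤z/1)
                    (cong (λ w → + ℤ.∣ w ∣) (sym (trans (cong ↥_ kv≡z) (↥[z/1]≡z z))))

  -- x lies in the cell (i/k, (i+1)/k] of index cell x; cell 0 also takes every x ≤ 0.
  cellBelow : ℕ → ℚ → ℕ
  cellBelow zero    x = 0
  cellBelow (suc m) x with x ≤? grid (suc m)
  ... | yes _ = cellBelow m x
  ... | no  _ = suc m

  cell : ℚ → ℕ
  cell = cellBelow k-1

  cellBelow≤ : ∀ m x → cellBelow m x ℕ.≤ m
  cellBelow≤ zero    x = ℕ.z≤n
  cellBelow≤ (suc m) x with x ≤? grid (suc m)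
  ... | yes _ = ℕ.m≤n⇒m≤1+n (cellBelow≤ m x)
  ... | no  _ = ℕ.≤-refl

  ≤-grid-cellBelow : ∀ m {x} → x ≤ grid (suc m) → x ≤ grid (suc (cellBelow m x))
  ≤-grid-cellBelow zero    x≤g = x≤g
  ≤-grid-cellBelow (suc m) {x} x≤g with x ≤? grid (suc m)
  ... | yes x≤g′ = ≤-grid-cellBelow m x≤g′
  ... | no  _    = x≤g

  grid-cellBelow-< : ∀ m {x} → 0ℚ < x → grid (cellBelow m x) < x
  grid-cellBelow-< zero    0<x = subst (_< _) (sym grid-0) 0<x
  grid-cellBelow-< (suc m) {x} 0<x with x ≤? grid (suc m)
  ... | yes _   = grid-cellBelow-< m 0<x
  ... | no  x≰g = ≰⇒> x≰g

  cell<k : ∀ x → cell x ℕ.< k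
  cell<k x = ℕ.s≤s (cellBelow≤ k-1 x)

  x≤1⇒x≤grid[1+cell] : ∀ {x} → x ≤ 1ℚ → x ≤ grid (suc (cell x))
  x≤1⇒x≤grid[1+cell] x≤1 = ≤-grid-cellBelow k-1 (subst (_ ≤_) (sym grid-k) x≤1)

  cellBelow-≡0 : ∀ m {x} → x ≤ grid 1 → cellBelow m x ≡ 0
  cellBelow-≡0 zero    _   = refl
  cellBelow-≡0 (suc m) {x} x≤g₁ with x ≤? grid (suc m)
  ... | yes _   = cellBelow-≡0 m x≤g₁
  ... | no  x≰g = ⊥-elim (x≰g (≤-trans x≤g₁ (grid-mono-≤ (ℕ.s≤s ℕ.z≤n))))

  cellBelow-≡ : ∀ m {i x} → i ℕ.≤ m → grid i < x → x ≤ grid (suc i) → cellBelow m x ≡ i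
  cellBelow-≡ zero    ℕ.z≤n _ _ = refl
  cellBelow-≡ (suc m) {i} {x} i≤1+m g<x x≤g with x ≤? grid (suc m) | ℕ.m≤n⇒m<n∨m≡n i≤1+m
  ... | yes _    | inj₁ i<1+m = cellBelow-≡ m (ℕ.s≤s⁻¹ i<1+m) g<x x≤g
  ... | yes x≤g′ | inj₂ refl  = ⊥-elim (<⇒≱ g<x x≤g′)
  ... | no  x≰g′ | inj₁ i<1+m = ⊥-elim (x≰g′ (≤-trans x≤g (grid-mono-≤ i<1+m)))
  ... | no  _    | inj₂ refl  = refl

  cellBelow-mono : ∀ m {x y} → x ≤ y → cellBelow m x ℕ.≤ cellBelow m y
  cellBelow-mono zero    _   = ℕ.z≤n
  cellBelow-mono (suc m) {x} {y} x≤y with x ≤? grid (suc m) | y ≤? grid (suc m)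
  ... | yes _   | yes _   = cellBelow-mono m x≤y
  ... | yes _   | no  _   = ℕ.m≤n⇒m≤1+n (cellBelow≤ m x)
  ... | no  x≰g | yes y≤g = ⊥-elim (x≰g (≤-trans x≤y y≤g))
  ... | no  _   | no  _   = ℕ.≤-refl

  grid-cell≤ : ∀ {x} → 0ℚ ≤ x → grid (cell x) ≤ x
  grid-cell≤ {x} 0≤x with 0ℚ <? x
  ... | yes 0<x = <⇒≤ (grid-cellBelow-< k-1 0<x)
  ... | no  0≮x = subst (_≤ x) (trans (sym grid-0) (cong grid (sym (cellBelow-≡0 k-1 x≤g₁)))) 0≤x
    where x≤g₁ = ≤-trans (≮⇒≥ 0≮x) (0≤grid 1)

  stepFunction : (ℕ → ℕ) → ℚ → ℚ
  stepFunction d x = grid (d (cell x))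

module StepFunction (k-1 : ℕ) (d : ℕ → ℕ) (admissible : Admissibility.Admissible (suc k-1) d) where

  open import Data.Nat as ℕ using (suc)
  import Data.Nat.Properties as ℕ
  open import Data.Integer as ℤ using (ℤ; +_)
  open import Data.Rational
  open import Data.Rational.Properties
  open import Data.List using (List; map; upTo)
  open import Data.List.Membership.Propositional.Properties using (∈-map⁺; ∈-upTo⁺)
  open import Data.Product using (∃; _×_; _,_)
  open import Relation.Binary.PropositionalEquality
  open import Relation.Nullary using (¬_; Dec; yes; no)
  open Rationals
  open Analysis
  open Grid k-1
  open Admissibility.Admissible admissible

  F : ℚ → ℚ
  F = stepFunction d

  F-on-cell : ∀ {i x} → i ℕ.< k → grid i < x → x ≤ grid (suc i) → F x ≡ grid (d i)
  F-on-cell i<k gi<x x≤gi+1 = cong (λ i → grid (d i)) (cellBelow-≡ k-1 (ℕ.s≤s⁻¹ i<k) gi<x x≤gi+1)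

  F-near-0 : ∀ {x} → x ≤ grid 1 → F x ≡ 1ℚ
  F-near-0 x≤g₁ = trans (cong (λ i → grid (d i)) (cellBelow-≡0 k-1 x≤g₁)) (trans (cong grid d0≡k) grid-k)

  F-maps : MapsInto01 F
  F-maps x _ = grid∈[0,1] (d≤k (cell<k x))

  F-decreasing : WeaklyDecreasing F
  F-decreasing x y _ _ x≤y = grid-mono-≤ (antitone-≤ (cellBelow-mono k-1 x≤y) (cell<k y))

  breakpoints : List ℚ
  breakpoints = map grid (upTo (suc k))

  F-piecewiseConstant : PiecewiseConstant F
  F-piecewiseConstant = breakpoints , constant-between-breakpoints
    where
    constant-between-breakpoints : ∀ x z → 0ℚ ≤ x → x < z → z ≤ 1ℚ → NoBreakIn breakpoints x z → F x ≡ F z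
    constant-between-breakpoints x z 0≤x x<z z≤1 free = sym (F-on-cell (cell<k x) (<-trans gi<x x<z) (<⇒≤ z<gi+1))
      where
      not-between : ∀ {j} → j ℕ.≤ k → ¬ (x ≤ grid j × grid j ≤ z)
      not-between j≤k = free _ (∈-map⁺ grid (∈-upTo⁺ (ℕ.s≤s j≤k)))
      z<gi+1 : z < grid (suc (cell x))
      z<gi+1 = ≰⇒> (λ gi+1≤z → not-between (cell<k x) (x≤1⇒x≤grid[1+cell] (≤-trans (<⇒≤ x<z) z≤1) , gi+1≤z))
      gi<x : grid (cell x) < x
      gi<x = ≰⇒> (λ x≤gi → not-between (ℕ.<⇒≤ (cell<k x)) (x≤gi , ≤-trans (grid-cell≤ 0≤x) (<⇒≤ x<z)))

  F-oneNearZero : OneNearZero F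
  F-oneNearZero = grid 1 , 0<grid (ℕ.s≤s ℕ.z≤n) , λ x _ x<g₁ → F-near-0 (<⇒≤ x<g₁)

  0<F1 : 0ℚ < F 1ℚ
  0<F1 = 0<grid (0<d (cell<k 1ℚ))

  1-a<grid : ∀ {e j a} → k ℕ.≤ e ℕ.+ j → grid j < a → 1ℚ - a < grid e
  1-a<grid {e} {j} {a} k≤e+j gj<a = p<q+r⇒p-r<q (begin-strict
    1ℚ               ≡⟨ grid-k ⟨
    grid k           ≤⟨ grid-mono-≤ k≤e+j ⟩
    grid (e ℕ.+ j)   ≡⟨ grid-+ e j ⟨
    grid e + grid j  <⟨ +-monoʳ-< (grid e) gj<a ⟩
    grid e + a       ∎)
    where open ≤-Reasoning

  F-aboveDiagonal : RightLimitAboveDiagonal F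
  F-aboveDiagonal a 0<a a<1 = limit (a <? grid (suc i))
    where
    i = cell a
    gi<a = grid-cellBelow-< k-1 0<a
    limit : Dec (a < grid (suc i)) → ∃ λ c → RightLimit F a c × 1ℚ - a < c
    limit (yes a<gi+1) =
      grid (d i) ,
      const⇒RightLimit a<gi+1 (λ x a<x x<gi+1 → F-on-cell (cell<k a) (<-trans gi<a a<x) (<⇒≤ x<gi+1)) ,
      1-a<grid (k≤d+i (cell<k a)) gi<a
    limit (no a≮gi+1) =
      grid (d (suc i)) ,
      const⇒RightLimit a<gi+2 (λ x a<x x<gi+2 → F-on-cell i+1<k (subst (_< x) a≡gi+1 a<x) (<⇒≤ x<gi+2)) ,
      1-a<grid (ℕ.≤-pred (subst (k ℕ.<_) (ℕ.+-suc (d (suc i)) i) (above-diagonal i+1<k))) gi<a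
      where
      a≡gi+1 = ≤-antisym (x≤1⇒x≤grid[1+cell] (<⇒≤ a<1)) (≮⇒≥ a≮gi+1)
      i+1<k = grid-cancel-< (subst₂ _<_ a≡gi+1 (sym grid-k) a<1)
      a<gi+2 = subst (_< grid (suc (suc i))) (sym a≡gi+1) (grid-mono-< (ℕ.n<1+n (suc i)))

  F-left-constant : ∀ x → In01 x → ∃ λ l → l < x × ∀ y → In01 y → l < y → y ≤ x → F y ≡ F x
  F-left-constant x (_ , x≤1) with 0ℚ <? x
  ... | yes 0<x = grid (cell x) , grid-cellBelow-< k-1 0<x ,
                  λ y _ gi<y y≤x → F-on-cell (cell<k x) gi<y (≤-trans y≤x (x≤1⇒x≤grid[1+cell] x≤1))
  ... | no  0≮x = x - 1ℚ , 0<r⇒p-r<p x (positive⁻¹ 1ℚ) ,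
                  λ y _ _ y≤x → trans (F-near-0 (y≤g₁ y≤x)) (sym (F-near-0 x≤g₁))
    where
    x≤g₁ = ≤-trans (≮⇒≥ 0≮x) (0≤grid 1)
    y≤g₁ : ∀ {y} → y ≤ x → y ≤ grid 1
    y≤g₁ y≤x = ≤-trans y≤x x≤g₁

  F-grid : ∀ {i} → i ℕ.< k → F (grid (suc i)) ≡ grid (d i)
  F-grid i<k = F-on-cell i<k (grid-mono-< (ℕ.n<1+n _)) ≤-refl

  F-integral : ∀ i → 1 ℕ.≤ i → i ℕ.≤ k → ∃ λ (z : ℤ) → (+ k / 1) * F (frac i k) ≡ ℤ→ℚ z
  F-integral (suc i) _ i<k = + d i , (begin
    k/1 * F (frac (suc i) k)   ≡⟨ cong (λ v → k/1 * F v) (grid≡frac (suc i)) ⟨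
    k/1 * F (grid (suc i))     ≡⟨ cong (k/1 *_) (F-grid i<k) ⟩
    k/1 * grid (d i)           ≡⟨ k/1*grid (d i) ⟩
    + d i / 1                  ∎)
    where open ≡-Reasoning

  F-linear-on-cells : ∀ i → 1 ℕ.≤ i → i ℕ.≤ k → ∃ λ (m : ℤ) → m ℤ.≤ + 0 × ∃ λ (b : ℚ) →
             ∀ x → frac (i ℕ.∸ 1) k < x → x < frac i k → F x ≡ ℤ→ℚ m * x + b
  F-linear-on-cells (suc i) _ i<k = + 0 , ℤ.+≤+ ℕ.z≤n , grid (d i) , λ x gi<x x<gi+1 → begin
    F x                    ≡⟨ F-on-cell i<k (subst (_< x) (sym (grid≡frac i)) gi<x)
                                            (<⇒≤ (subst (x <_) (sym (grid≡frac (suc i))) x<gi+1)) ⟩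
    grid (d i)             ≡⟨ +-identityˡ (grid (d i)) ⟨
    0ℚ + grid (d i)        ≡⟨ cong (_+ grid (d i)) (*-zeroˡ x) ⟨
    0ℚ * x + grid (d i)    ∎
    where open ≡-Reasoning

  F-∈P̃ : InPtilde k F × PiecewiseConstant F
  F-∈P̃ = ( ( F-maps , F-decreasing , PiecewiseConstant⇒PiecewiseLinear F-piecewiseConstant
           , F-oneNearZero , 0<F1 , F-aboveDiagonal )
         , F-integral , left-constant⇒UpperSemicontinuous F-decreasing F-left-constant , F-linear-on-cells )
         , F-piecewiseConstant

module CellValues (k-1 : ℕ) (f : ℚ → ℚ) (f∈P̃ : InPtilde (suc k-1) f) (f-pc : PiecewiseConstant f) where

  open import Data.Nat as ℕ using (suc)
  import Data.Nat.Properties as ℕ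
  open import Data.Integer as ℤ using (ℤ; +_)
  open import Data.Rational
  open import Data.Rational.Properties
  open import Data.Product using (∃; _,_; proj₁; proj₂)
  open import Data.Empty using (⊥-elim)
  open import Relation.Binary.PropositionalEquality
  open import Relation.Nullary using (yes; no)
  open import Relation.Binary.Definitions using (tri<; tri≈; tri>)
  open Rationals
  open Analysis
  open Grid k-1
  open Admissibility using (Admissible)

  private
    f∈P = proj₁ f∈P̃
    f-maps = proj₁ f∈P
    f-decreasing = proj₁ (proj₂ f∈P)
    f-oneNearZero = proj₁ (proj₂ (proj₂ (proj₂ f∈P)))
    f-aboveDiagonal = proj₂ (proj₂ (proj₂ (proj₂ (proj₂ f∈P))))
    f-integral = proj₁ (proj₂ f∈P̃)
    f-usc = proj₁ (proj₂ (proj₂ f∈P̃))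
    f-affine = proj₂ (proj₂ (proj₂ f∈P̃))

  f-constant-inside-cell : ∀ {i} → i ℕ.< k → ∃ λ b → ∀ x → grid i < x → x < grid (suc i) → f x ≡ b
  f-constant-inside-cell {i} i<k =
    let m , _ , b , affine = f-affine (suc i) (ℕ.s≤s ℕ.z≤n) i<k in
    b , PiecewiseConstant∧affine⇒constant {m = ℤ→ℚ m} f-pc (0≤grid i) (grid-mono-< (ℕ.n<1+n i))
          (proj₂ (grid∈[0,1] i<k))
          (λ x gi<x x<gi+1 → affine x (subst (_< x) (grid≡frac i) gi<x) (subst (x <_) (grid≡frac (suc i)) x<gi+1))

  f-on-cell : ∀ {i x} → i ℕ.< k → grid i < x → x ≤ grid (suc i) → f x ≡ f (grid (suc i))
  f-on-cell {i} {x} i<k gi<x x≤gi+1 with <-cmp x (grid (suc i))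
  ... | tri< x<gi+1 _ _ =
    let b , const = f-constant-inside-cell i<k in
    trans (const x gi<x x<gi+1)
          (sym (UpperSemicontinuous⇒right-end-≡ f-usc f-decreasing (grid∈[0,1] (ℕ.<⇒≤ i<k)) (grid∈[0,1] i<k)
                  (grid-mono-< (ℕ.n<1+n i)) const))
  ... | tri≈ _ x≡gi+1 _ = cong f x≡gi+1
  ... | tri> _ _ x>gi+1 = ⊥-elim (<⇒≱ x>gi+1 x≤gi+1)

  -- Read off through the numerator, so that the value does not depend on the integrality witness.
  values : ℕ → ℕ
  values i = ℤ.∣ ↥ (k/1 * f (grid (suc i))) ∣

  f-grid : ∀ {i} → i ℕ.< k → f (grid (suc i)) ≡ grid (values i)
  f-grid {i} i<k =
    let z , kf≡z = f-integral (suc i) (ℕ.s≤s ℕ.z≤n) i<k in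
    integral⇒grid {z = z} (proj₁ (f-maps _ (grid∈[0,1] i<k)))
                  (subst (λ v → k/1 * f v ≡ ℤ→ℚ z) (sym (grid≡frac (suc i))) kf≡z)

  f[grid1]≡1 : f (grid 1) ≡ 1ℚ
  f[grid1]≡1 =
    let ε , 0<ε , f≡1 = f-oneNearZero
        x , 0<x , x<ε⊓g₁ = <-dense (<-⊓ 0<ε (0<grid {1} (ℕ.s≤s ℕ.z≤n)))
        g₀<x = subst (_< x) (sym grid-0) 0<x
    in trans (sym (f-on-cell (ℕ.s≤s ℕ.z≤n) g₀<x (<⇒≤ (<-≤-trans x<ε⊓g₁ (p⊓q≤q ε (grid 1))))))
             (f≡1 x (<⇒≤ 0<x) (<-≤-trans x<ε⊓g₁ (p⊓q≤p ε (grid 1))))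

  values-above-diagonal : ∀ {i} → suc i ℕ.< k → k ℕ.< values (suc i) ℕ.+ suc i
  values-above-diagonal {i} i+1<k = grid-cancel-< (begin-strict
    grid k                                ≡⟨ grid-k ⟩
    1ℚ                                    <⟨ p-r<q⇒p<q+r (<-≤-trans 1-a<c (≤-reflexive c≡v)) ⟩
    grid (values (suc i)) + grid (suc i)  ≡⟨ grid-+ (values (suc i)) (suc i) ⟩
    grid (values (suc i) ℕ.+ suc i)       ∎)
    where
    open ≤-Reasoning
    a = grid (suc i)
    limit = f-aboveDiagonal a (0<grid (ℕ.s≤s ℕ.z≤n)) (subst (a <_) grid-k (grid-mono-< i+1<k))
    c = proj₁ limit
    1-a<c = proj₂ (proj₂ limit)
    c≡v : c ≡ grid (values (suc i))
    c≡v = RightLimit-const⇒≡ (grid-mono-< (ℕ.n<1+n (suc i))) (proj₂ (grid∈[0,1] i+1<k))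
            (λ x a<x x<gi+2 → trans (f-on-cell i+1<k a<x (<⇒≤ x<gi+2)) (f-grid i+1<k)) (proj₁ (proj₂ limit))

  values-admissible : Admissible k values
  values-admissible = record
    { d0≡k           = grid-injective (trans (sym (f-grid (ℕ.s≤s ℕ.z≤n))) (trans f[grid1]≡1 (sym grid-k)))
    ; antitone       = λ {i} i+1<k → grid-cancel-≤ (subst₂ _≤_ (f-grid i+1<k) (f-grid (ℕ.<-trans (ℕ.n<1+n i) i+1<k))
                         (f-decreasing _ _ (grid∈[0,1] (ℕ.<⇒≤ i+1<k)) (grid∈[0,1] i+1<k) (grid-mono-≤ (ℕ.n≤1+n (suc i)))))
    ; above-diagonal = values-above-diagonal
    }

  open StepFunction k-1 values values-admissible using (F; F-near-0)

  f≈F : f ≈₀₁ F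
  f≈F x (0≤x , x≤1) with 0ℚ <? x
  ... | yes 0<x = trans (f-on-cell (cell<k x) (grid-cellBelow-< k-1 0<x) (x≤1⇒x≤grid[1+cell] x≤1)) (f-grid (cell<k x))
  ... | no  0≮x = trans (proj₂ (proj₂ f-oneNearZero) x 0≤x (≤-<-trans x≤0 (proj₁ (proj₂ f-oneNearZero))))
                        (sym (F-near-0 (≤-trans x≤0 (0≤grid 1))))
    where x≤0 = ≮⇒≥ 0≮x

module Counting where

  open import Data.Fin using (zero; suc)
  open import Data.List using (List; length; lookup)
  open import Data.List.Membership.Propositional using (_∈_)
  open import Data.List.Membership.Propositional.Properties using (∈-lookup)
  open import Data.List.Relation.Unary.All as All using ()
  open import Data.List.Relation.Unary.AllPairs using (_∷_)
  open import Data.List.Relation.Unary.Any using (index)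
  open import Data.List.Relation.Unary.Any.Properties using (lookup-index)
  open import Data.List.Relation.Unary.Unique.Propositional using (Unique)
  open import Data.Product using (∃; _×_; _,_)
  open import Data.Empty using (⊥-elim)
  open import Relation.Binary.PropositionalEquality

  Unique⇒lookup-injective : ∀ {A : Set} {xs : List A} → Unique xs → ∀ i j → lookup xs i ≡ lookup xs j → i ≡ j
  Unique⇒lookup-injective (_ ∷ _)      zero    zero    _  = refl
  Unique⇒lookup-injective (x∉xs ∷ _)   zero    (suc j) eq = ⊥-elim (All.lookup x∉xs (∈-lookup j) eq)
  Unique⇒lookup-injective (x∉xs ∷ _)   (suc i) zero    eq = ⊥-elim (All.lookup x∉xs (∈-lookup i) (sym eq))
  Unique⇒lookup-injective (_ ∷ unique) (suc i) (suc j) eq = cong suc (Unique⇒lookup-injective unique i j eq)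

  HasExactly-length : ∀ {P : (ℚ → ℚ) → Set} {A : Set} (xs : List A) (F : A → ℚ → ℚ) → Unique xs →
    (∀ {a} → a ∈ xs → P (F a)) →
    (∀ {a b} → a ∈ xs → b ∈ xs → F a ≈₀₁ F b → a ≡ b) →
    (∀ f → P f → ∃ λ a → a ∈ xs × f ≈₀₁ F a) →
    HasExactly P (length xs)
  HasExactly-length xs F unique F∈P F-injective F-surjective =
    (λ i → F (lookup xs i)) ,
    (λ i → F∈P (∈-lookup i)) ,
    (λ i j Fi≈Fj → Unique⇒lookup-injective unique i j (F-injective (∈-lookup i) (∈-lookup j) Fi≈Fj)) ,
    λ f f∈P → let a , a∈xs , f≈Fa = F-surjective f f∈P in
      index a∈xs , λ x x∈ → trans (f≈Fa x x∈) (cong (λ b → F b x) (lookup-index a∈xs))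

module Enumeration (k-1 : ℕ) where

  open import Data.Nat as ℕ using (zero; suc)
  import Data.Nat.Properties as ℕ
  open import Data.Nat.Combinatorics using (_C_)
  open import Data.Nat.DivMod using (m*n/n≡m)
  open import Data.List using (List; _∷_; map; length; applyUpTo)
  open import Data.List.Properties using (length-map; length-applyUpTo; ∷-injectiveʳ)
  open import Data.List.Membership.Propositional using (_∈_)
  open import Data.List.Membership.Propositional.Properties using (∈-map⁻; ∈-map⁺)
  open import Data.List.Relation.Unary.Unique.Propositional using (Unique)
  import Data.List.Relation.Unary.Unique.Propositional.Properties as Unique
  open import Data.Product using (∃; _×_; _,_)
  open import Relation.Binary.PropositionalEquality
  open BallotNumbers
  open Staircases
  open Admissibility
  open Grid k-1

  PiecewiseConstantP̃ : (ℚ → ℚ) → Set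
  PiecewiseConstantP̃ f = InPtilde k f × PiecewiseConstant f

  valueLists : List (List ℕ)
  valueLists = map (k ∷_) (staircases k-1 k 0)

  ∈-valueLists⁻ : ∀ {s} → s ∈ valueLists → ∃ λ t → s ≡ k ∷ t × Staircase k k t × length t ≡ k-1
  ∈-valueLists⁻ s∈ with ∈-map⁻ (k ∷_) s∈
  ... | t , t∈ , s≡k∷t with ∈-staircases⁻ k-1 k 0 t∈
  ... | len , st = t , s≡k∷t , st , len

  admissible : ∀ {s} → s ∈ valueLists → Admissible k (entry s)
  admissible s∈ with ∈-valueLists⁻ s∈
  ... | t , refl , st , len = staircase⇒admissible st len

  stepFunction-∈ : ∀ {s} → s ∈ valueLists → PiecewiseConstantP̃ (stepFunction (entry s))
  stepFunction-∈ s∈ = StepFunction.F-∈P̃ k-1 _ (admissible s∈)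

  stepFunction-injective : ∀ {s s′} → s ∈ valueLists → s′ ∈ valueLists →
                           stepFunction (entry s) ≈₀₁ stepFunction (entry s′) → s ≡ s′
  stepFunction-injective {s} {s′} s∈ s′∈ F≈F′ = entry-ext (trans (length≡k s∈) (sym (length≡k s′∈))) λ i<len →
      let i<k = subst (_ ℕ.<_) (length≡k s∈) i<len in
      grid-injective (trans (sym (F-grid s∈ i<k)) (trans (F≈F′ _ (grid∈[0,1] i<k)) (F-grid s′∈ i<k)))
    where
    F-grid : ∀ {s i} → (s∈ : s ∈ valueLists) → i ℕ.< k → stepFunction (entry s) (grid (suc i)) ≡ grid (entry s i)
    F-grid s∈ = StepFunction.F-grid k-1 _ (admissible s∈)
    length≡k : ∀ {s} → s ∈ valueLists → length s ≡ k
    length≡k s∈ with ∈-valueLists⁻ s∈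
    ... | t , refl , _ , len = cong suc len

  stepFunction-surjective : ∀ f → PiecewiseConstantP̃ f → ∃ λ s → s ∈ valueLists × f ≈₀₁ stepFunction (entry s)
  stepFunction-surjective f (f∈P̃ , f-pc) =
    k ∷ t , k∷t∈ , λ x x∈ → trans (f≈F x x∈) (cong grid (sym (entry-d (cell<k x))))
    where
    open CellValues k-1 f f∈P̃ f-pc using (values; values-admissible; f≈F)
    d = values
    t = applyUpTo (λ i → d (suc i)) k-1
    k∷t∈ : k ∷ t ∈ valueLists
    k∷t∈ = ∈-map⁺ (k ∷_) (subst (λ n → t ∈ staircases n k 0) (length-applyUpTo _ k-1)
                            (∈-staircases⁺ k 0 (admissible⇒staircase values-admissible)))
    entry-d : ∀ {i} → i ℕ.< k → entry (k ∷ t) i ≡ d i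
    entry-d {zero}  _   = sym (Admissible.d0≡k values-admissible)
    entry-d {suc i} i<k = entry-applyUpTo (λ i → d (suc i)) (ℕ.s≤s⁻¹ i<k)

  valueLists-unique : Unique valueLists
  valueLists-unique = Unique.map⁺ ∷-injectiveʳ (staircases-unique k-1 k 0 (ℕ.s≤s (ℕ.≤-reflexive (ℕ.+-identityʳ k-1))))

  length-valueLists : length valueLists ≡ ((2 ℕ.* k-1) C k-1) ℕ./ k
  length-valueLists = begin
    length valueLists            ≡⟨ length-map (k ∷_) (staircases k-1 k 0) ⟩
    length (staircases k-1 k 0)  ≡⟨ length-staircases k-1 k 0 ⟩
    ballot k-1 0                 ≡⟨ m*n/n≡m (ballot k-1 0) k ⟨
    (ballot k-1 0 ℕ.* k) ℕ./ k   ≡⟨ cong (ℕ._/ k) (ballot[n,0]*[1+n]≡[2n]Cn k-1) ⟩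
    ((2 ℕ.* k-1) C k-1) ℕ./ k    ∎
    where open ≡-Reasoning

open import Data.Nat using (ℕ; NonZero; _*_; _∸_; _/_)
open import Data.Nat.Combinatorics using (_C_)
open import Data.Product using (_×_)
open import Relation.Binary.PropositionalEquality using (subst)

proposition4p3 : (k : ℕ) → .{{_ : NonZero k}} →
    HasExactly (λ f → InPtilde k f × PiecewiseConstant f) (((2 * (k ∸ 1)) C (k ∸ 1)) / k)
proposition4p3 (suc k-1) = subst (HasExactly PiecewiseConstantP̃) length-valueLists
  (HasExactly-length valueLists (λ s → stepFunction (entry s)) valueLists-unique
     stepFunction-∈ stepFunction-injective stepFunction-surjective)
  where
  open Counting using (HasExactly-length)
  open Staircases using (entry)
  open Grid k-1 using (stepFunction)
  open Enumeration k-1
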